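{- For any $t\colon \mathbb{N}_+ \to \mathbb{N}_+$, the class $\mathrm{ACA}(O(t))$ is closed under union.
   Context: A cellular automaton (CA) is $C=(Q,\delta,\Sigma)$ with finite state set $Q$, local rule $\delta\colon Q^3\to Q$, input alphabet $\Sigma\subseteq Q$, and an inactive state $q\in Q\setminus\Sigma$ with $\delta(z_1,z_2,z_3)=q$ iff $z_2=q$; the global map is $\Delta(c)(z)=\delta(c(z-1),c(z),c(z+1))$ on $Q^{\mathbb{Z}}$. For input $w\in\Sigma^+$ the initial configuration has $c_0(i)=w(i)$ for $0\le i<|w|$ and $q$ elsewhere. An ACA additionally has a nonempty set $A\subseteq Q\setminus\{q\}$ of accept states and accepts $w$ if some $\Delta^\tau(c_0)$ has all cells in $A\cup\{q\}$; the least such $\tau$ is the acceptance time. $\mathrm{ACA}(t)$ is the class of languages $L(C)$ of ACAs accepting every $w\in L(C)$ within $t(|w|)$ steps, and $\mathrm{ACA}(O(t))$ is the union of $\mathrm{ACA}(t')$ over $t'\in O(t)$. -}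

module Defs where

open import Data.Nat using (ℕ; zero; suc; _≤_; _*_)
open import Data.Integer using (ℤ; +_; -[1+_]; _+_; _-_)
open import Data.Fin using (Fin)
open import Data.Bool using (Bool; true; false)
open import Data.List using (List; []; _∷_; length)
open import Data.Maybe using (Maybe; just; nothing; maybe)
open import Data.Product using (Σ; ∃; ∃-syntax; _×_; _,_)
open import Data.Sum using (_⊎_)
open import Function.Bundles using (_⇔_)
open import Function.Definitions using (Injective)
open import Relation.Binary.PropositionalEquality using (_≡_; _≢_)

Word : ℕ → Set
Word k = List (Fin k)

Language : ℕ → Set₁
Language k = Word k → Set

_∪ᴸ_ : ∀ {k} → Language k → Language k → Language k
(L₁ ∪ᴸ L₂) w = L₁ w ⊎ L₂ w

-- An ACA with input alphabet Σ = Fin k.  The state set is Q = Fin n;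
-- Σ ⊆ Q is realised by the injective embedding ι.
record ACA (k : ℕ) : Set where
  field
    n      : ℕ
    δ      : Fin n → Fin n → Fin n → Fin n
    ι      : Fin k → Fin n
    ι-inj  : Injective _≡_ _≡_ ι
    q      : Fin n
    q∉Σ    : ∀ a → ι a ≢ q
    δ-q    : ∀ z₁ z₂ z₃ → (δ z₁ z₂ z₃ ≡ q) ⇔ (z₂ ≡ q)
    A      : Fin n → Bool
    A-ne   : ∃[ a ] A a ≡ true
    q∉A    : A q ≡ false

  Config : Set
  Config = ℤ → Fin n

  Δ : Config → Config
  Δ c z = δ (c (z - + 1)) (c z) (c (z + + 1))

  iterΔ : ℕ → Config → Config
  iterΔ zero    c = c
  iterΔ (suc m) c = Δ (iterΔ m c)

  nth : Word k → ℕ → Maybe (Fin k)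
  nth []      _       = nothing
  nth (a ∷ w) zero    = just a
  nth (a ∷ w) (suc i) = nth w i

  init : Word k → Config
  init w (+ i)      = maybe ι q (nth w i)
  init w -[1+ _ ]   = q

  AllAccepting : Config → Set
  AllAccepting c = ∀ z → (A (c z) ≡ true) ⊎ (c z ≡ q)

  AcceptsAt : Word k → ℕ → Set
  AcceptsAt w τ = AllAccepting (iterΔ τ (init w))

  L : Language k
  L w = (1 ≤ length w) × ∃[ τ ] AcceptsAt w τ

  -- accepted within b steps (acceptance time, the least τ, is ≤ b)
  AcceptsWithin : Word k → ℕ → Set
  AcceptsWithin w b = ∃[ τ ] (τ ≤ b × AcceptsAt w τ)

-- Functions ℕ₊ → ℕ₊ are modelled as t : ℕ → ℕ, only ever evaluated at
-- positive arguments, with positive values there.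
PosFun : (ℕ → ℕ) → Set
PosFun t = ∀ m → 1 ≤ m → 1 ≤ t m

BigO : (ℕ → ℕ) → (ℕ → ℕ) → Set
BigO t' t = ∃[ c ] ∃[ m₀ ] (∀ m → m₀ ≤ m → 1 ≤ m → t' m ≤ c * t m)

InACA : ∀ {k} → (ℕ → ℕ) → Language k → Set
InACA {k} t L = Σ (ACA k) λ C →
  (∀ w → L w ⇔ ACA.L C w) × (∀ w → ACA.L C w → ACA.AcceptsWithin C w (t (length w)))

InACA-O : ∀ {k} → (ℕ → ℕ) → Language k → Set
InACA-O t L = ∃[ t' ] (PosFun t' × BigO t' t × InACA t' L)

module Submission where

-- Run C₁ and C₂ alternately on one tape: a cell holds a state of each automaton and a phase
-- bit, even steps advance the C₁ component, odd steps the C₂ component, and a cell counts as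
-- accepting when the component about to move is accepting.  The interleaving thus accepts at
-- time 2τ iff C₁ accepts at τ, and at time 2τ + 1 iff C₂ accepts at τ, so it recognises
-- L₁ ∪ L₂ within 1 + 2 (t₁ + t₂) ∈ O(t) steps.  C₁ and C₂ are inactive on exactly the same
-- cells at all times (those outside the input), so the pair of inactive states can serve as
-- the inactive state of the interleaving.

open import Defs
open import Data.Nat using (ℕ; zero; suc; _*_; _+_; _⊔_; z≤n; s≤s)
open import Data.Nat.Properties
  using (*-suc; *-assoc; *-identityˡ; *-monoʳ-≤; *-distribʳ-+; +-mono-≤; ≤-trans; ≤-reflexive;
         m≤m+n; m≤n+m; m≤m⊔n; m≤n⊔m; n≤1+n)
open import Data.Integer using (+_; -[1+_]; _-_) renaming (_+_ to _+ℤ_)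
open import Data.Fin using (Fin; zero; suc; combine; remQuot)
open import Data.Fin.Properties using (remQuot-combine) renaming (_≟_ to _≟ᶠ_)
open import Data.Bool using (Bool; true; false)
open import Data.List using ([]; _∷_; length)
open import Data.Maybe using (maybe)
open import Data.Product using (_×_; _,_; proj₁; ∃-syntax; map₂)
open import Data.Sum using (_⊎_; inj₁; inj₂; [_,_])
open import Data.Empty using (⊥-elim)
open import Function using (const)
open import Function.Bundles using (_⇔_; mk⇔; Equivalence)
import Function.Properties.Equivalence as ⇔
open import Relation.Nullary using (¬_; yes; no)
open import Relation.Binary.PropositionalEquality
  using (_≡_; _≢_; refl; sym; trans; cong; cong₂; subst; module ≡-Reasoning)

even-or-odd : ∀ n → ∃[ m ] (n ≡ 2 * m ⊎ n ≡ suc (2 * m))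
even-or-odd zero = zero , inj₁ refl
even-or-odd (suc n) with even-or-odd n
... | m , inj₁ refl = m , inj₂ refl
... | m , inj₂ refl = suc m , inj₁ (sym (*-suc 2 m))

⊎-⇔-¬ʳ : ∀ {A B : Set} → ¬ B → (A ⊎ B) ⇔ A
⊎-⇔-¬ʳ ¬b = mk⇔ (λ { (inj₁ a) → a ; (inj₂ b) → ⊥-elim (¬b b) }) inj₁

∀-⇔ : ∀ {I : Set} {P Q : I → Set} → (∀ i → P i ⇔ Q i) → (∀ i → P i) ⇔ (∀ i → Q i)
∀-⇔ P⇔Q = mk⇔ (λ p i → Equivalence.to (P⇔Q i) (p i)) (λ q i → Equivalence.from (P⇔Q i) (q i))

BigO-one : ∀ {t} → PosFun t → BigO (const 1) t
BigO-one {t} t-pos = 1 , 0 , λ m _ m-pos → ≤-trans (t-pos m m-pos) (≤-reflexive (sym (*-identityˡ (t m))))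

BigO-*ˡ : ∀ {f t} a → BigO f t → BigO (λ m → a * f m) t
BigO-*ˡ {f} {t} a (c , m₀ , f≤ct) = a * c , m₀ , λ m m₀≤m m-pos →
  ≤-trans (*-monoʳ-≤ a (f≤ct m m₀≤m m-pos)) (≤-reflexive (sym (*-assoc a c (t m))))

BigO-+ : ∀ {f g t} → BigO f t → BigO g t → BigO (λ m → f m + g m) t
BigO-+ {t = t} (c , m₀ , f≤ct) (d , n₀ , g≤dt) = c + d , m₀ ⊔ n₀ , λ m ⊔≤m m-pos →
  ≤-trans (+-mono-≤ (f≤ct m (≤-trans (m≤m⊔n m₀ n₀) ⊔≤m) m-pos)
                    (g≤dt m (≤-trans (m≤n⊔m m₀ n₀) ⊔≤m) m-pos))
          (≤-reflexive (sym (*-distribʳ-+ (t m) c d)))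

module _ {k} (C : ACA k) where
  open ACA C

  iterΔ-inactive : ∀ τ c z → iterΔ τ c z ≡ q ⇔ c z ≡ q
  iterΔ-inactive zero c z = ⇔.refl
  iterΔ-inactive (suc τ) c z = ⇔.trans (δ-q _ _ _) (iterΔ-inactive τ c z)

init-inactive-agree : ∀ {k} (C D : ACA k) w z → ACA.init C w z ≡ ACA.q C → ACA.init D w z ≡ ACA.q D
init-inactive-agree C D w -[1+ _ ] _ = refl
init-inactive-agree C D w (+ i) = outside w i
  where
  outside : ∀ w i → maybe (ACA.ι C) (ACA.q C) (ACA.nth C w i) ≡ ACA.q C →
            maybe (ACA.ι D) (ACA.q D) (ACA.nth D w i) ≡ ACA.q D
  outside [] i _ = refl
  outside (a ∷ w) zero ιa≡q = ⊥-elim (ACA.q∉Σ C a ιa≡q)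
  outside (a ∷ w) (suc i) = outside w i

module Interleave {k} (C₁ C₂ : ACA k) where
  private
    module C₁ = ACA C₁
    module C₂ = ACA C₂

  Pair Cell : Set
  Pair = Fin C₁.n × Fin C₂.n
  Cell = Fin C₁.n × Fin C₂.n × Fin 2

  -- A state is either the inactive state zero or suc (encode (a , b , p)), where the phase p
  -- says which of C₁ (p = zero) and C₂ (p = suc zero) moves next.
  N : ℕ
  N = suc (C₁.n * (C₂.n * 2))

  encode : Cell → Fin (C₁.n * (C₂.n * 2))
  encode (a , b , p) = combine a (combine b p)

  decode : Fin (C₁.n * (C₂.n * 2)) → Cell
  decode i = map₂ (remQuot 2) (remQuot {C₁.n} (C₂.n * 2) i)

  decode-encode : ∀ x → decode (encode x) ≡ x
  decode-encode (a , b , p) =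
    trans (cong (map₂ (remQuot 2)) (remQuot-combine {C₁.n} a (combine b p)))
          (cong (a ,_) (remQuot-combine {C₂.n} b p))

  pair : Fin N → Pair
  pair zero = C₁.q , C₂.q
  pair (suc i) = map₂ proj₁ (decode i)

  pair-encode : ∀ x → pair (suc (encode x)) ≡ map₂ proj₁ x
  pair-encode x = cong (map₂ proj₁) (decode-encode x)

  advance : Pair → Cell → Pair → Cell
  advance (a₋ , _) (a , b , zero) (a₊ , _) = C₁.δ a₋ a a₊ , b , suc zero
  advance (_ , b₋) (a , b , suc _) (_ , b₊) = a , C₂.δ b₋ b b₊ , zero

  δ : Fin N → Fin N → Fin N → Fin N
  δ _ zero _ = zero
  δ l (suc i) r = suc (encode (advance (pair l) (decode i) (pair r)))

  accepting : Cell → Bool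
  accepting (a , _ , zero) = C₁.A a
  accepting (_ , b , suc _) = C₂.A b

  A : Fin N → Bool
  A zero = false
  A (suc i) = accepting (decode i)

  A-encode : ∀ x → A (suc (encode x)) ≡ accepting x
  A-encode x = cong accepting (decode-encode x)

  ι : Fin k → Fin N
  ι a = suc (encode (C₁.ι a , C₂.ι a , zero))

  ι-injective : ∀ {a a′} → ι a ≡ ι a′ → a ≡ a′
  ι-injective {a} {a′} ιa≡ιa′ = C₁.ι-inj (cong proj₁
    (trans (sym (pair-encode (C₁.ι a , C₂.ι a , zero)))
           (trans (cong pair ιa≡ιa′) (pair-encode (C₁.ι a′ , C₂.ι a′ , zero)))))

  interleaving : ACA k
  interleaving = record
    { n = N
    ; δ = δ
    ; ι = ι
    ; ι-inj = ι-injective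
    ; q = zero
    ; q∉Σ = λ _ ()
    ; δ-q = δ-inactive
    ; A = A
    ; A-ne = accepting-state C₁.A-ne
    ; q∉A = refl
    }
    where
    accepting-state : ∃[ a ] C₁.A a ≡ true → ∃[ s ] A s ≡ true
    accepting-state (a , Aa) = suc (encode (a , C₂.q , zero)) , trans (A-encode (a , C₂.q , zero)) Aa

    δ-inactive : ∀ l s r → δ l s r ≡ zero ⇔ s ≡ zero
    δ-inactive l zero r = ⇔.refl
    δ-inactive l (suc s) r = mk⇔ (λ ()) (λ ())

  private
    module P = ACA interleaving

  ⌜_⌝ : Cell → Fin N
  ⌜ a , b , p ⌝ with a ≟ᶠ C₁.q
  ... | yes _ = zero
  ... | no _ = suc (encode (a , b , p))

  ⌜⌝-inactive : ∀ {a b p} → a ≡ C₁.q → ⌜ a , b , p ⌝ ≡ zero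
  ⌜⌝-inactive {a} a≡q with a ≟ᶠ C₁.q
  ... | yes _ = refl
  ... | no a≢q = ⊥-elim (a≢q a≡q)

  ⌜⌝-active : ∀ {a b p} → a ≢ C₁.q → ⌜ a , b , p ⌝ ≡ suc (encode (a , b , p))
  ⌜⌝-active {a} a≢q with a ≟ᶠ C₁.q
  ... | yes a≡q = ⊥-elim (a≢q a≡q)
  ... | no _ = refl

  Matched : Pair → Set
  Matched (a , b) = a ≡ C₁.q ⇔ b ≡ C₂.q

  pair-⌜⌝ : ∀ {a b p} → Matched (a , b) → pair ⌜ a , b , p ⌝ ≡ (a , b)
  pair-⌜⌝ {a} {b} {p} a~b with a ≟ᶠ C₁.q
  ... | yes a≡q = sym (cong₂ _,_ a≡q (Equivalence.to a~b a≡q))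
  ... | no _ = pair-encode (a , b , p)

  advance-inactive : ∀ l x r → proj₁ (advance l x r) ≡ C₁.q ⇔ proj₁ x ≡ C₁.q
  advance-inactive (a₋ , _) (a , _ , zero) (a₊ , _) = C₁.δ-q a₋ a a₊
  advance-inactive _ (_ , _ , suc _) _ = ⇔.refl

  δ-⌜⌝ : ∀ {a₋ b₋ p₋ a₊ b₊ p₊} x → Matched (a₋ , b₋) → Matched (a₊ , b₊) →
         δ ⌜ a₋ , b₋ , p₋ ⌝ ⌜ x ⌝ ⌜ a₊ , b₊ , p₊ ⌝ ≡ ⌜ advance (a₋ , b₋) x (a₊ , b₊) ⌝
  δ-⌜⌝ {a₋} {b₋} {p₋} {a₊} {b₊} {p₊} x@(a , b , p) l~ r~ with a ≟ᶠ C₁.q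
  ... | yes a≡q = sym (⌜⌝-inactive (Equivalence.from (advance-inactive (a₋ , b₋) x (a₊ , b₊)) a≡q))
  ... | no a≢q = begin
    suc (encode (advance (pair ⌜ a₋ , b₋ , p₋ ⌝) (decode (encode x)) (pair ⌜ a₊ , b₊ , p₊ ⌝)))
      ≡⟨ cong suc (cong encode (cong₂ (λ l r → advance l (decode (encode x)) r) (pair-⌜⌝ l~) (pair-⌜⌝ r~))) ⟩
    suc (encode (advance (a₋ , b₋) (decode (encode x)) (a₊ , b₊)))
      ≡⟨ cong (λ y → suc (encode (advance (a₋ , b₋) y (a₊ , b₊)))) (decode-encode x) ⟩
    suc (encode (advance (a₋ , b₋) x (a₊ , b₊)))
      ≡⟨ sym (⌜⌝-active (λ e → a≢q (Equivalence.to (advance-inactive (a₋ , b₋) x (a₊ , b₊)) e))) ⟩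
    ⌜ advance (a₋ , b₋) x (a₊ , b₊) ⌝ ∎
    where open ≡-Reasoning

  Synchronised : C₁.Config → C₂.Config → Set
  Synchronised c₁ c₂ = ∀ z → Matched (c₁ z , c₂ z)

  Represents : P.Config → C₁.Config → C₂.Config → Fin 2 → Set
  Represents c c₁ c₂ p = ∀ z → c z ≡ ⌜ c₁ z , c₂ z , p ⌝

  Δ-represents : ∀ {c c₁ c₂ p} → Synchronised c₁ c₂ → Represents c c₁ c₂ p → ∀ z →
    P.Δ c z ≡ ⌜ advance (c₁ (z - + 1) , c₂ (z - + 1)) (c₁ z , c₂ z , p) (c₁ (z +ℤ + 1) , c₂ (z +ℤ + 1)) ⌝
  Δ-represents {c₁ = c₁} {c₂} {p} sync rep z
    rewrite rep (z - + 1) | rep z | rep (z +ℤ + 1) = δ-⌜⌝ (c₁ z , c₂ z , p) (sync _) (sync _)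

  CellAccepting : Cell → Set
  CellAccepting (a , _ , zero) = C₁.A a ≡ true ⊎ a ≡ C₁.q
  CellAccepting (_ , b , suc _) = C₂.A b ≡ true ⊎ b ≡ C₂.q

  StateAccepting : Fin N → Set
  StateAccepting s = A s ≡ true ⊎ s ≡ zero

  StateAccepting-encode : ∀ x → StateAccepting (suc (encode x)) ⇔ (accepting x ≡ true)
  StateAccepting-encode x rewrite A-encode x = ⊎-⇔-¬ʳ λ ()

  StateAccepting-⌜⌝ : ∀ {a b} p → Matched (a , b) → StateAccepting ⌜ a , b , p ⌝ ⇔ CellAccepting (a , b , p)
  StateAccepting-⌜⌝ {a} {b} p a~b with a ≟ᶠ C₁.q
  StateAccepting-⌜⌝ zero a~b | yes a≡q = mk⇔ (const (inj₂ a≡q)) (const (inj₂ refl))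
  StateAccepting-⌜⌝ (suc _) a~b | yes a≡q = mk⇔ (const (inj₂ (Equivalence.to a~b a≡q))) (const (inj₂ refl))
  StateAccepting-⌜⌝ {a} {b} p a~b | no a≢q =
    ⇔.trans (StateAccepting-encode (a , b , p)) (⇔.sym (accepted p))
    where
    accepted : ∀ p → CellAccepting (a , b , p) ⇔ (accepting (a , b , p) ≡ true)
    accepted zero = ⊎-⇔-¬ʳ a≢q
    accepted (suc _) = ⊎-⇔-¬ʳ (λ b≡q → a≢q (Equivalence.from a~b b≡q))

  AllAccepting-represents : ∀ {c c₁ c₂ p} → Synchronised c₁ c₂ → Represents c c₁ c₂ p →
    P.AllAccepting c ⇔ (∀ z → CellAccepting (c₁ z , c₂ z , p))
  AllAccepting-represents {p = p} sync rep = ∀-⇔ λ z →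
    subst (λ s → StateAccepting s ⇔ _) (sym (rep z)) (StateAccepting-⌜⌝ p (sync z))

  module Run (w : Word k) where
    run₁ : ℕ → C₁.Config
    run₁ τ = C₁.iterΔ τ (C₁.init w)

    run₂ : ℕ → C₂.Config
    run₂ τ = C₂.iterΔ τ (C₂.init w)

    run : ℕ → P.Config
    run T = P.iterΔ T (P.init w)

    synchronised : ∀ τ τ′ → Synchronised (run₁ τ) (run₂ τ′)
    synchronised τ τ′ z =
      ⇔.trans (iterΔ-inactive C₁ τ _ z)
        (⇔.trans (mk⇔ (init-inactive-agree C₁ C₂ w z) (init-inactive-agree C₂ C₁ w z))
          (⇔.sym (iterΔ-inactive C₂ τ′ _ z)))

    represents-init : Represents (run 0) (run₁ 0) (run₂ 0) zero
    represents-init -[1+ _ ] = sym (⌜⌝-inactive refl)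
    represents-init (+ i) = inside w i
      where
      inside : ∀ w i → maybe ι zero (P.nth w i) ≡
               ⌜ maybe C₁.ι C₁.q (C₁.nth w i) , maybe C₂.ι C₂.q (C₂.nth w i) , zero ⌝
      inside [] i = sym (⌜⌝-inactive refl)
      inside (a ∷ w) zero = sym (⌜⌝-active (C₁.q∉Σ a))
      inside (a ∷ w) (suc i) = inside w i

    represents-even : ∀ τ → Represents (run (2 * τ)) (run₁ τ) (run₂ τ) zero
    represents-odd : ∀ τ → Represents (run (suc (2 * τ))) (run₁ (suc τ)) (run₂ τ) (suc zero)
    represents-even zero = represents-init
    represents-even (suc τ) = subst (λ T → Represents (run T) (run₁ (suc τ)) (run₂ (suc τ)) zero)
      (sym (*-suc 2 τ)) (Δ-represents (synchronised (suc τ) τ) (represents-odd τ))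
    represents-odd τ = Δ-represents (synchronised τ τ) (represents-even τ)

    accepts-even : ∀ τ → P.AcceptsAt w (2 * τ) ⇔ C₁.AcceptsAt w τ
    accepts-even τ = AllAccepting-represents (synchronised τ τ) (represents-even τ)

    accepts-odd : ∀ τ → P.AcceptsAt w (suc (2 * τ)) ⇔ C₂.AcceptsAt w τ
    accepts-odd τ = AllAccepting-represents (synchronised (suc τ) τ) (represents-odd τ)

    accepts-either : ∀ T → P.AcceptsAt w T → (∃[ τ ] C₁.AcceptsAt w τ) ⊎ (∃[ τ ] C₂.AcceptsAt w τ)
    accepts-either T acc with even-or-odd T
    ... | τ , inj₁ refl = inj₁ (τ , Equivalence.to (accepts-even τ) acc)
    ... | τ , inj₂ refl = inj₂ (τ , Equivalence.to (accepts-odd τ) acc)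

    within-even : ∀ {b₁} b₂ → C₁.AcceptsWithin w b₁ → P.AcceptsWithin w (1 + 2 * (b₁ + b₂))
    within-even b₂ (τ , τ≤b₁ , acc) =
      2 * τ , ≤-trans (*-monoʳ-≤ 2 (≤-trans τ≤b₁ (m≤m+n _ b₂))) (n≤1+n _) ,
      Equivalence.from (accepts-even τ) acc

    within-odd : ∀ b₁ {b₂} → C₂.AcceptsWithin w b₂ → P.AcceptsWithin w (1 + 2 * (b₁ + b₂))
    within-odd b₁ (τ , τ≤b₂ , acc) =
      suc (2 * τ) , s≤s (*-monoʳ-≤ 2 (≤-trans τ≤b₂ (m≤n+m _ b₁))) ,
      Equivalence.from (accepts-odd τ) acc

InACA-∪ : ∀ {k t₁ t₂} {L₁ L₂ : Language k} → InACA t₁ L₁ → InACA t₂ L₂ →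
          InACA (λ m → 1 + 2 * (t₁ m + t₂ m)) (L₁ ∪ᴸ L₂)
InACA-∪ {t₁ = t₁} {t₂} {L₁} {L₂} (C₁ , L₁⇔ , fast₁) (C₂ , L₂⇔ , fast₂) =
  interleaving , union , fast
  where
  open Interleave C₁ C₂

  union : ∀ w → (L₁ ∪ᴸ L₂) w ⇔ ACA.L interleaving w
  union w = mk⇔ to from
    where
    open Run w
    to : (L₁ ∪ᴸ L₂) w → ACA.L interleaving w
    to (inj₁ l₁) = let len , τ , acc = Equivalence.to (L₁⇔ w) l₁ in
                   len , 2 * τ , Equivalence.from (accepts-even τ) acc
    to (inj₂ l₂) = let len , τ , acc = Equivalence.to (L₂⇔ w) l₂ in
                   len , suc (2 * τ) , Equivalence.from (accepts-odd τ) acc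
    from : ACA.L interleaving w → (L₁ ∪ᴸ L₂) w
    from (len , T , acc) with accepts-either T acc
    ... | inj₁ acc₁ = inj₁ (Equivalence.from (L₁⇔ w) (len , acc₁))
    ... | inj₂ acc₂ = inj₂ (Equivalence.from (L₂⇔ w) (len , acc₂))

  fast : ∀ w → ACA.L interleaving w →
         ACA.AcceptsWithin interleaving w (1 + 2 * (t₁ (length w) + t₂ (length w)))
  fast w (len , T , acc) =
    [ (λ acc₁ → within-even (t₂ (length w)) (fast₁ w (len , acc₁)))
    , (λ acc₂ → within-odd (t₁ (length w)) (fast₂ w (len , acc₂)))
    ] (accepts-either T acc)
    where open Run w

proposition1 : (t : ℕ → ℕ) → PosFun t → (k : ℕ) → (L₁ L₂ : Language k) →
    InACA-O t L₁ → InACA-O t L₂ → InACA-O t (L₁ ∪ᴸ L₂)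
proposition1 t t-pos k L₁ L₂ (t₁ , _ , t₁∈O[t] , L₁∈ACA[t₁]) (t₂ , _ , t₂∈O[t] , L₂∈ACA[t₂]) =
  (λ m → 1 + 2 * (t₁ m + t₂ m)) ,
  (λ _ _ → s≤s z≤n) ,
  BigO-+ {g = λ m → 2 * (t₁ m + t₂ m)} (BigO-one t-pos) (BigO-*ˡ 2 (BigO-+ t₁∈O[t] t₂∈O[t])) ,
  InACA-∪ {t₁ = t₁} {t₂} L₁∈ACA[t₁] L₂∈ACA[t₂]
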